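{- Let $p\ge 1$, $d=4p+3$, $\pi=0\diamondsuit0\diamondsuit$, and for $1\le j\le p$ let $\beta_j=11\,\pi^{p-1}\,0\,\diamondsuit^{4j+1}\,000\,\diamondsuit^{d}$. Let $S=11s_1\ldots s_p0$ be a solid binary string with $s_i\approx\pi$ (each $s_i$ of length $4$) for every $i$. Then $S$ covers $\beta_j$ if and only if $s_j\ne 0101$.
   Context: Binary partial words are strings over $\{0,1,\diamondsuit\}$, where $\diamondsuit$ is a don't care symbol matching both $0$ and $1$; a solid string contains no $\diamondsuit$. Two partial words $U,V$ match ($U\approx V$) if $|U|=|V|$ and for each $i$, $U[i]=V[i]$ or one of them is $\diamondsuit$. Exponents denote repetition ($x^r$ is $r$ copies of $x$). A solid string $S$ occurs in a partial word $T$ at position $j$ if $S\approx T[j..j+|S|-1]$. $S$ covers $T$ (is a cover of $T$) if every position $i$ of $T$ lies in some occurrence of $S$, i.e., there is an occurrence at some $j\in\{i-|S|+1,\ldots,i\}$. -}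

module Defs where

open import Data.Bool using (Bool; true; false)
open import Data.Nat using (ℕ; zero; suc; _+_; _*_; _≤_; _<_)
open import Data.List using (List; []; _∷_; _++_; length; drop; take; replicate; concat; map)
open import Data.List.Relation.Binary.Pointwise using (Pointwise)
open import Data.Vec using (Vec; toList)
open import Data.Fin using (Fin; toℕ)
open import Data.List using (allFin)
open import Data.Product using (∃; _×_)

-- Letters of binary partial words: 0, 1 and the hole ◇ (don't care).
data Sym : Set where
  𝟘 𝟙 ◇ : Sym

-- Partial words; solid binary strings are lists of bits (false = 0, true = 1).
PWord : Set
PWord = List Sym

Solid : Set
Solid = List Bool

data BitMatch : Bool → Sym → Set where
  m0 : BitMatch false 𝟘
  m1 : BitMatch true 𝟙
  m◇ : ∀ {b} → BitMatch b ◇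

OccursAt : Solid → PWord → ℕ → Set
OccursAt S T j = Pointwise BitMatch S (take (length S) (drop j T))

Covers : Solid → PWord → Set
Covers S T = ∀ i → i < length T → ∃ λ j → j ≤ i × i < j + length S × OccursAt S T j

_^^_ : {A : Set} → List A → ℕ → List A
x ^^ r = concat (replicate r x)

π : PWord
π = 𝟘 ∷ ◇ ∷ 𝟘 ∷ ◇ ∷ []

-- β_j = 11 π^(p-1) 0 ◇^(4j+1) 000 ◇^d  with d = 4p+3;  here p = suc q, so p - 1 = q.
β : (q j : ℕ) → PWord
β q j = (𝟙 ∷ 𝟙 ∷ []) ++ (π ^^ q) ++ (𝟘 ∷ []) ++ replicate (4 * j + 1) ◇
        ++ (𝟘 ∷ 𝟘 ∷ 𝟘 ∷ []) ++ replicate (4 * suc q + 3) ◇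

-- S = 11 s_1 … s_p 0, with blocks indexed by Fin p (block k is s_{k+1}).
buildS : (p : ℕ) → (Fin p → Vec Bool 4) → Solid
buildS p s = (true ∷ true ∷ []) ++ concat (map (λ k → toList (s k)) (allFin p)) ++ (false ∷ [])

b0101 : Vec Bool 4
b0101 = Data.Vec._∷_ false (Data.Vec._∷_ true (Data.Vec._∷_ false (Data.Vec._∷_ true Data.Vec.[])))

-- Positions are 0-based.  S refines 11 π^p 0, which matches the prefix 11 π^(p-1) 0 ◇◇◇◇ of β_j,
-- so S occurs at 0; it also occurs on the trailing ◇^d.  No other occurrence can start inside
-- 11 π^(p-1) 0, since S begins with 11 and each later position of that prefix is 0 or followed
-- by a 0.  Hence position 4p+3, the first one missed by the occurrence at 0, is covered iff S
-- occurs at some 4p-1+c with c ≤ 4, where S only has to put 0s on the block 000 at 4p+4j.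
-- If s_j = 0101 one of its two 1s lands on that block for every c.  If s_j = 0x0y with x = 0,
-- S fits at 4p+2 (s_j on the block); if y = 0 it fits at 4p, the third 0 of the block then
-- meeting the first bit of s_(j+1) or the final 0 of S.
module Submission where

open import Defs
open import Data.Bool using (Bool; true; false)
open import Data.Nat using (ℕ; zero; suc; _+_; _*_; _≤_; _<_; z≤n; s≤s; s≤s⁻¹; _<?_)
open import Data.Nat.Properties
open import Data.Maybe using (Maybe; just; nothing)
open import Data.Maybe.Properties using (just-injective)
open import Data.List using (List; []; _∷_; _++_; length; drop; take; replicate; concat; map; tabulate; allFin)
open import Data.List.Properties using (length-++; length-replicate; map-tabulate; ++-assoc; ++-identityʳ)
open import Data.List.Relation.Binary.Pointwise using (Pointwise; []; _∷_; ++⁺; transitive; Pointwise-length)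
import Data.List.Relation.Binary.Pointwise as Pointwise
open import Data.Vec using (Vec; toList) renaming (_∷_ to _∷ᵛ_; [] to []ᵛ)
open import Data.Vec.Properties using (length-toList)
open import Data.Fin using (Fin; toℕ)
import Data.Fin as Fin
open import Data.Fin.Properties using (toℕ<n)
open import Data.Product using (∃; ∃₂; _×_; _,_)
open import Data.Sum using (_⊎_; inj₁; inj₂)
open import Data.Empty using (⊥; ⊥-elim)
open import Relation.Nullary using (¬_; yes; no)
open import Relation.Binary.PropositionalEquality
open import Function.Base using (_∘_; id)
open import Function.Bundles using (_⇔_; mk⇔; Equivalence)
open import Data.Nat.Tactic.RingSolver using (solve-∀)

infixl 9 _!?_

_!?_ : {A : Set} → List A → ℕ → Maybe A
[]       !? _     = nothing
(x ∷ xs) !? zero  = just x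
(x ∷ xs) !? suc i = xs !? i

module _ {A : Set} where

  !?-++ˡ : ∀ (xs : List A) {ys i x} → xs !? i ≡ just x → (xs ++ ys) !? i ≡ just x
  !?-++ˡ (y ∷ xs) {i = zero}  eq = eq
  !?-++ˡ (y ∷ xs) {i = suc i} eq = !?-++ˡ xs eq

  !?-++ʳ : ∀ (xs : List A) {ys} i → (xs ++ ys) !? (length xs + i) ≡ ys !? i
  !?-++ʳ []       i = refl
  !?-++ʳ (x ∷ xs) i = !?-++ʳ xs i

  !?-replicate : ∀ n {x : A} {i} → i < n → replicate n x !? i ≡ just x
  !?-replicate (suc n) {i = zero}  _       = refl
  !?-replicate (suc n) {i = suc i} (s≤s p) = !?-replicate n p

  !?-drop : ∀ t (xs : List A) u → drop t xs !? u ≡ xs !? (t + u)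
  !?-drop zero    xs       u = refl
  !?-drop (suc t) []       u = refl
  !?-drop (suc t) (x ∷ xs) u = !?-drop t xs u

  !?-take : ∀ n (xs : List A) i {x} → take n xs !? i ≡ just x → xs !? i ≡ just x
  !?-take (suc n) (y ∷ xs) zero    eq = eq
  !?-take (suc n) (y ∷ xs) (suc i) eq = !?-take n xs i eq

  !?⇒<length : ∀ (xs : List A) i {x} → xs !? i ≡ just x → i < length xs
  !?⇒<length (y ∷ xs) zero    _  = s≤s z≤n
  !?⇒<length (y ∷ xs) (suc i) eq = s≤s (!?⇒<length xs i eq)

  !?-concat-tabulate : ∀ {p n} (g : Fin p → List A) → (∀ k → length (g k) ≡ n) →
                       ∀ k {e x} → g k !? e ≡ just x → concat (tabulate g) !? (toℕ k * n + e) ≡ just x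
  !?-concat-tabulate g len Fin.zero eq = !?-++ˡ (g Fin.zero) eq
  !?-concat-tabulate {n = n} g len (Fin.suc k) {e} {x} eq = begin
      concat (tabulate g) !? (n + toℕ k * n + e)   ≡⟨ cong (concat (tabulate g) !?_) (+-assoc n (toℕ k * n) e) ⟩
      concat (tabulate g) !? (n + (toℕ k * n + e)) ≡⟨ cong (λ m → concat (tabulate g) !? (m + _)) (sym (len Fin.zero)) ⟩
      concat (tabulate g) !? (length (g Fin.zero) + (toℕ k * n + e)) ≡⟨ !?-++ʳ (g Fin.zero) _ ⟩
      concat (tabulate (λ k → g (Fin.suc k))) !? (toℕ k * n + e) ≡⟨ !?-concat-tabulate (λ k → g (Fin.suc k)) (λ k → len (Fin.suc k)) k eq ⟩
      just x ∎
    where open ≡-Reasoning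

  drop-length-++ : ∀ (xs : List A) {ys} t → drop (length xs + t) (xs ++ ys) ≡ drop t ys
  drop-length-++ []       t = refl
  drop-length-++ (x ∷ xs) t = drop-length-++ xs t

  take-length-++ : ∀ (xs : List A) {ys} → take (length xs) (xs ++ ys) ≡ xs
  take-length-++ []       = refl
  take-length-++ (x ∷ xs) = cong (x ∷_) (take-length-++ xs)

  ^^-suc : ∀ (xs : List A) n → xs ^^ suc n ≡ xs ^^ n ++ xs
  ^^-suc xs zero    = ++-identityʳ xs
  ^^-suc xs (suc n) = trans (cong (xs ++_) (^^-suc xs n)) (sym (++-assoc xs (xs ^^ n) xs))

module _ {A B : Set} {R : A → B → Set} where

  Pointwise-!? : ∀ {xs ys} → Pointwise R xs ys → ∀ i {x} → xs !? i ≡ just x → ∃ λ y → ys !? i ≡ just y × R x y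
  Pointwise-!? (r ∷ rs) zero    refl = _ , refl , r
  Pointwise-!? (r ∷ rs) (suc i) eq   = Pointwise-!? rs i eq

  Pointwise-concat-tabulate : ∀ {p ys} (g : Fin p → List A) → (∀ k → Pointwise R (g k) ys) →
                              Pointwise R (concat (tabulate g)) (ys ^^ p)
  Pointwise-concat-tabulate {zero}  g h = []
  Pointwise-concat-tabulate {suc p} g h = ++⁺ (h Fin.zero) (Pointwise-concat-tabulate (λ k → g (Fin.suc k)) (λ k → h (Fin.suc k)))

  Pointwise-take⇔ : ∀ xs ys → Pointwise R xs (take (length xs) ys) ⇔ (∀ i {x} → xs !? i ≡ just x → ∃ λ y → ys !? i ≡ just y × R x y)
  Pointwise-take⇔ xs ys = mk⇔ (to xs ys) (from xs ys)
    where
    to : ∀ xs ys → Pointwise R xs (take (length xs) ys) → ∀ i {x} → xs !? i ≡ just x → ∃ λ y → ys !? i ≡ just y × R x y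
    to xs ys rs i eq with Pointwise-!? rs i eq
    ... | y , eq′ , r = y , !?-take (length xs) ys i eq′ , r
    from : ∀ xs ys → (∀ i {x} → xs !? i ≡ just x → ∃ λ y → ys !? i ≡ just y × R x y) → Pointwise R xs (take (length xs) ys)
    from []       ys       h = []
    from (x ∷ xs) []       h with h 0 refl
    ... | _ , () , _
    from (x ∷ xs) (y ∷ ys) h with h 0 refl
    ... | .y , refl , r = r ∷ from xs ys (λ i → h (suc i))

MatchesAt : Solid → PWord → ℕ → Set
MatchesAt S T t = ∀ u {b} → S !? u ≡ just b → ∃ λ c → T !? (t + u) ≡ just c × BitMatch b c

occursAt⇔matchesAt : ∀ S T t → OccursAt S T t ⇔ MatchesAt S T t
occursAt⇔matchesAt S T t = mk⇔
  (λ occ u {b} eq → let c , eq′ , m = Equivalence.to (Pointwise-take⇔ S (drop t T)) occ u eq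
                    in c , trans (sym (!?-drop t T u)) eq′ , m)
  (λ mat → Equivalence.from (Pointwise-take⇔ S (drop t T))
             (λ u {b} eq → let c , eq′ , m = mat u eq in c , trans (!?-drop t T u) eq′ , m))

¬occursAt-1↦𝟘 : ∀ {S} T t u → S !? u ≡ just true → T !? (t + u) ≡ just 𝟘 → ¬ OccursAt S T t
¬occursAt-1↦𝟘 {S} T t u eqS eqT occ with Equivalence.to (occursAt⇔matchesAt S T t) occ u eqS
... | c , eq , m with trans (sym eq) eqT
¬occursAt-1↦𝟘 T t u eqS eqT occ | .𝟘 , eq , () | refl

occursAt-++ : ∀ S (xs : PWord) {ys} t → OccursAt S (xs ++ ys) (length xs + t) ≡ OccursAt S ys t
occursAt-++ S xs t = cong (λ T → Pointwise BitMatch S (take (length S) T)) (drop-length-++ xs t)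

covers-from-three : ∀ {S T j j′} → j ≤ length S → j′ ≤ j + length S → length T ≤ j′ + length S →
                    OccursAt S T 0 → OccursAt S T j → OccursAt S T j′ → Covers S T
covers-from-three {S} {T} {j} {j′} j≤S j′≤ T≤ occ₀ occ occ′ i i<T with i <? length S | i <? j′
... | yes i<S | _        = 0 , z≤n , i<S , occ₀
... | no i≮S  | yes i<j′ = j , ≤-trans j≤S (≮⇒≥ i≮S) , <-≤-trans i<j′ j′≤ , occ
... | no _    | no i≮j′  = j′ , ≮⇒≥ i≮j′ , <-≤-trans i<T T≤ , occ′

data _⊑_ : Sym → Sym → Set where
  ⊑-refl : ∀ {x} → x ⊑ x
  ⊑-◇    : ∀ {x} → x ⊑ ◇

BitMatch-⊑ : ∀ {b x y} → BitMatch b x → x ⊑ y → BitMatch b y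
BitMatch-⊑ m ⊑-refl = m
BitMatch-⊑ m ⊑-◇    = m◇

occursAt-0-⊑ : ∀ {S X} Y {Z} → Pointwise BitMatch S X → Pointwise _⊑_ X Y → OccursAt S (Y ++ Z) 0
occursAt-0-⊑ Y {Z} S≈X X⊑Y
  rewrite trans (Pointwise-length S≈X) (Pointwise-length X⊑Y) | take-length-++ Y {Z}
  = transitive BitMatch-⊑ S≈X X⊑Y

frame : ℕ → PWord
frame n = 𝟙 ∷ 𝟙 ∷ π ^^ n ++ 𝟘 ∷ []

frame-++ : ∀ n xs → frame n ++ xs ≡ 𝟙 ∷ 𝟙 ∷ π ^^ n ++ 𝟘 ∷ xs
frame-++ n xs = cong (λ w → 𝟙 ∷ 𝟙 ∷ w) (++-assoc (π ^^ n) (𝟘 ∷ []) xs)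

length-π^^ : ∀ n → length (π ^^ n) ≡ 4 * n
length-π^^ zero    = refl
length-π^^ (suc n) = trans (cong (4 +_) (length-π^^ n)) (sym (*-suc 4 n))

length-frame : ∀ n → length (frame n) ≡ 4 * n + 3
length-frame n = begin
  2 + length (π ^^ n ++ 𝟘 ∷ []) ≡⟨ cong (2 +_) (length-++ (π ^^ n)) ⟩
  2 + (length (π ^^ n) + 1)     ≡⟨ cong (λ m → 2 + (m + 1)) (length-π^^ n) ⟩
  2 + (4 * n + 1)               ≡⟨ +-comm 2 (4 * n + 1) ⟩
  4 * n + 1 + 2                 ≡⟨ +-assoc (4 * n) 1 2 ⟩
  4 * n + 3                     ∎
  where open ≡-Reasoning

π^^-++-𝟘-at-4* : ∀ n m {xs} → m ≤ n → (π ^^ n ++ 𝟘 ∷ xs) !? (4 * m) ≡ just 𝟘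
π^^-++-𝟘-at-4* n       zero    _         = π^^-head n
  where
  π^^-head : ∀ n {xs} → (π ^^ n ++ 𝟘 ∷ xs) !? 0 ≡ just 𝟘
  π^^-head zero    = refl
  π^^-head (suc n) = refl
π^^-++-𝟘-at-4* (suc n) (suc m) {xs} (s≤s m≤n) =
  subst (λ i → (π ^^ suc n ++ 𝟘 ∷ xs) !? i ≡ just 𝟘) (sym (*-suc 4 m)) (π^^-++-𝟘-at-4* n m m≤n)

π^^-++-𝟘-pair : ∀ n v {xs} → v ≤ 4 * n →
                (π ^^ n ++ 𝟘 ∷ xs) !? v ≡ just 𝟘 ⊎ (π ^^ n ++ 𝟘 ∷ xs) !? suc v ≡ just 𝟘
π^^-++-𝟘-pair zero    zero                          _  = inj₁ refl
π^^-++-𝟘-pair (suc n) 0                             _  = inj₁ refl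
π^^-++-𝟘-pair (suc n) 1                             _  = inj₂ refl
π^^-++-𝟘-pair (suc n) 2                             _  = inj₁ refl
π^^-++-𝟘-pair (suc n) 3                             _  = inj₂ (π^^-++-𝟘-at-4* n 0 z≤n)
π^^-++-𝟘-pair (suc n) (suc (suc (suc (suc v)))) le =
  π^^-++-𝟘-pair n v (+-cancelˡ-≤ 4 v (4 * n) (subst (4 + v ≤_) (*-suc 4 n) le))

11π^^-++-𝟘-pair : ∀ n t {xs} → 1 ≤ t → t ≤ 4 * n + 2 →
                  (𝟙 ∷ 𝟙 ∷ π ^^ n ++ 𝟘 ∷ xs) !? t ≡ just 𝟘 ⊎ (𝟙 ∷ 𝟙 ∷ π ^^ n ++ 𝟘 ∷ xs) !? suc t ≡ just 𝟘
11π^^-++-𝟘-pair n 1             _ _  = inj₂ (π^^-++-𝟘-at-4* n 0 z≤n)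
11π^^-++-𝟘-pair n (suc (suc v)) _ t≤ =
  π^^-++-𝟘-pair n v (+-cancelˡ-≤ 2 v (4 * n) (subst (2 + v ≤_) (+-comm (4 * n) 2) t≤))

frame-suc-⊑ : ∀ n → Pointwise _⊑_ (frame (suc n)) (frame n ++ replicate 4 ◇)
frame-suc-⊑ n = subst₂ (Pointwise _⊑_) (sym frame-suc) (sym (frame-++ n (replicate 4 ◇)))
  (⊑-refl ∷ ⊑-refl ∷ ++⁺ (Pointwise.refl ⊑-refl) (⊑-refl ∷ ⊑-refl ∷ ⊑-◇ ∷ ⊑-refl ∷ ⊑-◇ ∷ []))
  where
  frame-suc : frame (suc n) ≡ 𝟙 ∷ 𝟙 ∷ π ^^ n ++ π ++ 𝟘 ∷ []
  frame-suc = cong (λ w → 𝟙 ∷ 𝟙 ∷ w) (trans (cong (_++ 𝟘 ∷ []) (^^-suc π n)) (++-assoc (π ^^ n) π (𝟘 ∷ [])))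

window : ℕ → ℕ → PWord
window a b = replicate a ◇ ++ 𝟘 ∷ 𝟘 ∷ 𝟘 ∷ replicate b ◇

length-window : ∀ a b → length (window a b) ≡ a + 3 + b
length-window a b = begin
  length (replicate a ◇ ++ _)                           ≡⟨ length-++ (replicate a ◇) ⟩
  length (replicate a ◇) + (3 + length (replicate b ◇)) ≡⟨ cong₂ (λ m n → m + (3 + n)) (length-replicate a) (length-replicate b) ⟩
  a + (3 + b)                                           ≡⟨ +-assoc a 3 b ⟨
  a + 3 + b                                             ∎
  where open ≡-Reasoning

window-◇ˡ : ∀ {a b v} → v < a → window a b !? v ≡ just ◇
window-◇ˡ {a} v<a = !?-++ˡ (replicate a ◇) (!?-replicate a v<a)

window-!?-a+ : ∀ a b i → window a b !? (a + i) ≡ (𝟘 ∷ 𝟘 ∷ 𝟘 ∷ replicate b ◇) !? i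
window-!?-a+ a b i =
  trans (cong (λ m → window a b !? (m + i)) (sym (length-replicate a))) (!?-++ʳ (replicate a ◇) i)

window-𝟘 : ∀ {a b e} → e < 3 → window a b !? (a + e) ≡ just 𝟘
window-𝟘 {a} {b} {e} e<3 = trans (window-!?-a+ a b e) (middle e<3)
  where
  middle : ∀ {e} → e < 3 → (𝟘 ∷ 𝟘 ∷ 𝟘 ∷ replicate b ◇) !? e ≡ just 𝟘
  middle {0} _ = refl
  middle {1} _ = refl
  middle {2} _ = refl
  middle {suc (suc (suc _))} (s≤s (s≤s (s≤s ())))

window-◇ʳ : ∀ {a b w} → w < b → window a b !? (a + 3 + w) ≡ just ◇
window-◇ʳ {a} {b} {w} w<b =
  trans (cong (window a b !?_) (+-assoc a 3 w)) (trans (window-!?-a+ a b (3 + w)) (!?-replicate b w<b))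

window-zones : ∀ a v → v < a ⊎ (∃ λ e → e < 3 × v ≡ a + e) ⊎ ∃ λ w → v ≡ a + 3 + w
window-zones a v with v <? a
... | yes v<a = inj₁ v<a
... | no v≮a with m≤n⇒∃[o]m+o≡n (≮⇒≥ v≮a)
...   | 0                 , eq = inj₂ (inj₁ (0 , s≤s z≤n , sym eq))
...   | 1                 , eq = inj₂ (inj₁ (1 , s≤s (s≤s z≤n) , sym eq))
...   | 2                 , eq = inj₂ (inj₁ (2 , s≤s (s≤s (s≤s z≤n)) , sym eq))
...   | suc (suc (suc w)) , eq = inj₂ (inj₂ (w , trans (sym eq) (sym (+-assoc a 3 w))))

occursAt-window : ∀ {S a b t} → t + length S ≤ a + 3 + b →
                  (∀ u e {x} → e < 3 → t + u ≡ a + e → S !? u ≡ just x → x ≡ false) →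
                  OccursAt S (window a b) t
occursAt-window {S} {a} {b} {t} fits zeros = Equivalence.from (occursAt⇔matchesAt S (window a b) t) matches
  where
  matches : MatchesAt S (window a b) t
  matches u {x} eq with window-zones a (t + u)
  ... | inj₁ v<a = ◇ , window-◇ˡ {a} {b} v<a , m◇
  ... | inj₂ (inj₁ (e , e<3 , v≡)) =
    𝟘 , trans (cong (window a b !?_) v≡) (window-𝟘 {a} {b} e<3) , subst (λ y → BitMatch y 𝟘) (sym (zeros u e e<3 v≡ eq)) m0
  ... | inj₂ (inj₂ (w , v≡)) = ◇ , trans (cong (window a b !?_) v≡) (window-◇ʳ {a} {b} w<b) , m◇
    where
    w<b : w < b
    w<b = +-cancelˡ-< (a + 3) w b
            (subst (_< a + 3 + b) v≡ (<-≤-trans (+-monoʳ-< t (!?⇒<length S u eq)) fits))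

¬occursAt-window : ∀ {S} a b t {u e} → e < 3 → t + u ≡ a + e → S !? u ≡ just true → ¬ OccursAt S (window a b) t
¬occursAt-window a b t e<3 t+u≡ S[u]≡1 = ¬occursAt-1↦𝟘 (window a b) t _ S[u]≡1 (trans (cong (window a b !?_) t+u≡) (window-𝟘 {a} {b} e<3))

BitMatch-𝟘 : ∀ {b} → BitMatch b 𝟘 → b ≡ false
BitMatch-𝟘 m0 = refl

π-shape : ∀ (v : Vec Bool 4) → Pointwise BitMatch (toList v) π → ∃₂ λ x y → v ≡ false ∷ᵛ x ∷ᵛ false ∷ᵛ y ∷ᵛ []ᵛ
π-shape (false ∷ᵛ x ∷ᵛ false ∷ᵛ y ∷ᵛ []ᵛ) (m0 ∷ _ ∷ m0 ∷ _ ∷ []) = x , y , refl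

module _ (p : ℕ) (s : Fin p → Vec Bool 4) where

  buildS-blocks : concat (map (λ k → toList (s k)) (allFin p)) ≡ concat (tabulate (λ k → toList (s k)))
  buildS-blocks = cong concat (map-tabulate (λ k → k) (λ k → toList (s k)))

  buildS≈frame : (∀ k → Pointwise BitMatch (toList (s k)) π) → Pointwise BitMatch (buildS p s) (frame p)
  buildS≈frame hyp = m1 ∷ m1 ∷ ++⁺ (subst (λ B → Pointwise BitMatch B (π ^^ p)) (sym buildS-blocks)
                                         (Pointwise-concat-tabulate (λ k → toList (s k)) hyp)) (m0 ∷ [])

  buildS-!?-block : ∀ k {e x} → toList (s k) !? e ≡ just x → buildS p s !? (2 + (toℕ k * 4 + e)) ≡ just x
  buildS-!?-block k eq = !?-++ˡ (concat (map (λ k → toList (s k)) (allFin p)))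
    (trans (cong (_!? _) buildS-blocks) (!?-concat-tabulate (λ k → toList (s k)) (λ k → length-toList (s k)) k eq))

module _ (q : ℕ) (s : Fin (suc q) → Vec Bool 4)
         (hyp : ∀ k → Pointwise BitMatch (toList (s k)) π) (k : Fin (suc q)) where

  private
    S : Solid
    S = buildS (suc q) s

    K : ℕ
    K = toℕ k

    a d : ℕ
    a = 4 * suc K + 1
    d = 4 * suc q + 3

    F : ℕ
    F = length (frame q)

    βj : PWord
    βj = β q (suc K)

  S≈frame : Pointwise BitMatch S (frame (suc q))
  S≈frame = buildS≈frame (suc q) s hyp

  length-S : length S ≡ d
  length-S = trans (Pointwise-length S≈frame) (length-frame (suc q))

  length-S≡F+4 : length S ≡ F + 4
  length-S≡F+4 = trans (Pointwise-length S≈frame) (trans (Pointwise-length (frame-suc-⊑ q)) (length-++ (frame q)))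

  K≤q : K ≤ q
  K≤q = s≤s⁻¹ (toℕ<n k)

  β≡frame++window : βj ≡ frame q ++ window a d
  β≡frame++window = sym (frame-++ q (window a d))

  length-β : length (βj) ≡ F + (a + 3 + d)
  length-β = trans (cong length β≡frame++window) (trans (length-++ (frame q)) (cong (F +_) (length-window a d)))

  occursAt-β≡window : ∀ t → OccursAt S (βj) (F + t) ≡ OccursAt S (window a d) t
  occursAt-β≡window t = trans (cong (λ T → OccursAt S T (F + t)) β≡frame++window) (occursAt-++ S (frame q) t)

  S-!?-block : ∀ {e x} → toList (s k) !? e ≡ just x → S !? (2 + (K * 4 + e)) ≡ just x
  S-!?-block = buildS-!?-block (suc q) s k

  S-block-bit : ∀ {e b x} → toList (s k) !? e ≡ just b → S !? (2 + (K * 4 + e)) ≡ just x → x ≡ b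
  S-block-bit s[e]≡b S[u]≡x = just-injective (trans (sym S[u]≡x) (S-!?-block s[e]≡b))

  S-𝟘-at-4* : ∀ m {x} → m ≤ suc q → S !? (2 + 4 * m) ≡ just x → x ≡ false
  S-𝟘-at-4* m m≤ S[u]≡x with Pointwise-!? S≈frame (2 + 4 * m) S[u]≡x
  ... | y , frame[u]≡y , match with trans (sym frame[u]≡y) (π^^-++-𝟘-at-4* (suc q) m m≤)
  ...   | refl = BitMatch-𝟘 match

  occursAt-0 : OccursAt S (βj) 0
  occursAt-0 = subst (λ T → OccursAt S T 0) (sym β-split)
                 (occursAt-0-⊑ (frame q ++ replicate 4 ◇) S≈frame (frame-suc-⊑ q))
    where
    β-split : βj ≡ (frame q ++ replicate 4 ◇) ++ window (4 * K + 1) d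
    β-split = begin
      βj                                          ≡⟨ β≡frame++window ⟩
      frame q ++ window a d                                ≡⟨ cong (λ m → frame q ++ window (m + 1) d) (*-suc 4 K) ⟩
      frame q ++ replicate 4 ◇ ++ window (4 * K + 1) d     ≡⟨ ++-assoc (frame q) (replicate 4 ◇) _ ⟨
      (frame q ++ replicate 4 ◇) ++ window (4 * K + 1) d   ∎
      where open ≡-Reasoning

  S-fits-window : ∀ {t} → t ≤ a + 3 → t + length S ≤ a + 3 + d
  S-fits-window {t} t≤ = subst (λ n → t + n ≤ a + 3 + d) (sym length-S) (+-monoˡ-≤ d t≤)

  occursAt-end : OccursAt S (window a d) (a + 3)
  occursAt-end = occursAt-window (S-fits-window ≤-refl) (λ u e e<3 eq _ → ⊥-elim (past-zeros e<3 eq))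
    where
    past-zeros : ∀ {u e} → e < 3 → a + 3 + u ≡ a + e → ⊥
    past-zeros {u} {e} e<3 eq =
      m+n≮m 3 u (subst (_< 3) (sym (+-cancelˡ-≡ a (3 + u) e (trans (sym (+-assoc a 3 u)) eq))) e<3)

  occursAt-middle-3 : ∀ y → s k ≡ false ∷ᵛ false ∷ᵛ false ∷ᵛ y ∷ᵛ []ᵛ → OccursAt S (window a d) 3
  occursAt-middle-3 y sk = occursAt-window (S-fits-window (m≤n+m 3 a)) zeros
    where
    shift : ∀ K e → 4 * suc K + 1 + e ≡ 3 + (2 + (K * 4 + e))
    shift = solve-∀
    zeros : ∀ u e {x} → e < 3 → 3 + u ≡ a + e → S !? u ≡ just x → x ≡ false
    zeros u e e<3 eq with +-cancelˡ-≡ 3 u (2 + (K * 4 + e)) (trans eq (shift K e))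
    zeros _ 0 _ _ | refl = S-block-bit (cong (λ v → toList v !? 0) sk)
    zeros _ 1 _ _ | refl = S-block-bit (cong (λ v → toList v !? 1) sk)
    zeros _ 2 _ _ | refl = S-block-bit (cong (λ v → toList v !? 2) sk)
    zeros _ (suc (suc (suc _))) (s≤s (s≤s (s≤s ()))) _ | refl

  occursAt-middle-1 : ∀ x → s k ≡ false ∷ᵛ x ∷ᵛ false ∷ᵛ false ∷ᵛ []ᵛ → OccursAt S (window a d) 1
  occursAt-middle-1 x sk = occursAt-window (S-fits-window (≤-trans (s≤s z≤n) (m≤n+m 3 a))) zeros
    where
    shift : ∀ K e → 4 * suc K + 1 + e ≡ 1 + (2 + (K * 4 + (2 + e)))
    shift = solve-∀
    next-block : ∀ K → 2 + (K * 4 + 4) ≡ 2 + 4 * suc K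
    next-block = solve-∀
    zeros : ∀ u e {x} → e < 3 → 1 + u ≡ a + e → S !? u ≡ just x → x ≡ false
    zeros u e e<3 eq with +-cancelˡ-≡ 1 u (2 + (K * 4 + (2 + e))) (trans eq (shift K e))
    zeros _ 0 _ _ | refl = S-block-bit (cong (λ v → toList v !? 2) sk)
    zeros _ 1 _ _ | refl = S-block-bit (cong (λ v → toList v !? 3) sk)
    zeros _ 2 {x} _ _ | refl = S-𝟘-at-4* (suc K) (s≤s K≤q) ∘ subst (λ u → S !? u ≡ just x) (next-block K)
    zeros _ (suc (suc (suc _))) (s≤s (s≤s (s≤s ()))) _ | refl

  covered-by-middle : ∀ {t} → 1 ≤ t → t ≤ 4 → OccursAt S (window a d) t → Covers S (βj)
  covered-by-middle {t} 1≤t t≤4 occ =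
    covers-from-three j≤S j′≤ β≤ occursAt-0 (to-β t occ) (to-β (a + 3) occursAt-end)
    where
    to-β : ∀ t → OccursAt S (window a d) t → OccursAt S (βj) (F + t)
    to-β t = subst id (sym (occursAt-β≡window t))
    j≤S : F + t ≤ length S
    j≤S = subst (F + t ≤_) (sym length-S≡F+4) (+-monoʳ-≤ F t≤4)
    middle-reaches-end : a + 3 ≤ t + length S
    middle-reaches-end = begin
      a + 3           ≡⟨ +-assoc (4 * suc K) 1 3 ⟩
      4 * suc K + 4   ≤⟨ +-monoˡ-≤ 4 (*-monoʳ-≤ 4 (s≤s K≤q)) ⟩
      4 * suc q + 4   ≡⟨ +-suc (4 * suc q) 3 ⟩
      1 + d           ≤⟨ +-monoˡ-≤ d 1≤t ⟩
      t + d           ≡⟨ cong (t +_) length-S ⟨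
      t + length S    ∎
      where open ≤-Reasoning
    j′≤ : F + (a + 3) ≤ F + t + length S
    j′≤ = subst (F + (a + 3) ≤_) (sym (+-assoc F t (length S))) (+-monoʳ-≤ F middle-reaches-end)
    β≤ : length (βj) ≤ F + (a + 3) + length S
    β≤ = ≤-reflexive (begin
      length (βj)   ≡⟨ length-β ⟩
      F + (a + 3 + d)        ≡⟨ +-assoc F (a + 3) d ⟨
      F + (a + 3) + d        ≡⟨ cong (F + (a + 3) +_) length-S ⟨
      F + (a + 3) + length S ∎)
      where open ≡-Reasoning

  covers-β⇐ : ¬ s k ≡ b0101 → Covers S (βj)
  covers-β⇐ s≢0101 with π-shape (s k) (hyp k)
  ... | false , y     , sk = covered-by-middle (s≤s z≤n) (s≤s (s≤s (s≤s z≤n))) (occursAt-middle-3 y sk)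
  ... | true  , false , sk = covered-by-middle (s≤s z≤n) (s≤s z≤n) (occursAt-middle-1 true sk)
  ... | true  , true  , sk = ⊥-elim (s≢0101 sk)

  ¬occursAt-window-≤4 : s k ≡ b0101 → ∀ c → c ≤ 4 → ¬ OccursAt S (window a d) c
  ¬occursAt-window-≤4 sk c c≤4 with ≤-total c 2
  ... | inj₁ c≤2 =
    ¬occursAt-window a d c (s≤s c≤2) (third-bit K c) (S-!?-block (cong (λ v → toList v !? 3) sk))
    where
    third-bit : ∀ K c → c + (2 + (K * 4 + 3)) ≡ 4 * suc K + 1 + c
    third-bit = solve-∀
  ... | inj₂ 2≤c with m≤n⇒∃[o]m+o≡n 2≤c
  ...   | e , refl =
    ¬occursAt-window a d (2 + e) (s≤s (+-cancelˡ-≤ 2 e 2 c≤4)) (first-bit K e) (S-!?-block (cong (λ v → toList v !? 1) sk))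
    where
    first-bit : ∀ K e → 2 + e + (2 + (K * 4 + 1)) ≡ 4 * suc K + 1 + e
    first-bit = solve-∀

  ¬occursAt-β : s k ≡ b0101 → ∀ t → 1 ≤ t → t ≤ length S → ¬ OccursAt S (βj) t
  ¬occursAt-β sk t 1≤t t≤S with t <? F
  ... | yes t<F with 11π^^-++-𝟘-pair q t 1≤t (s≤s⁻¹ (subst (t <_) (trans (length-frame q) (+-suc (4 * q) 2)) t<F))
  ...   | inj₁ β[t]≡𝟘   = ¬occursAt-1↦𝟘 (βj) t 0 refl (subst (λ i → βj !? i ≡ just 𝟘) (sym (+-identityʳ t)) β[t]≡𝟘)
  ...   | inj₂ β[1+t]≡𝟘 = ¬occursAt-1↦𝟘 (βj) t 1 refl (subst (λ i → βj !? i ≡ just 𝟘) (+-comm 1 t) β[1+t]≡𝟘)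
  ¬occursAt-β sk t 1≤t t≤S | no t≮F with m≤n⇒∃[o]m+o≡n (≮⇒≥ t≮F)
  ... | c , refl = ¬occursAt-window-≤4 sk c (+-cancelˡ-≤ F c 4 (subst (F + c ≤_) length-S≡F+4 t≤S))
                 ∘ subst id (occursAt-β≡window c)

  S<β : length S < length (βj)
  S<β = subst₂ _<_ (sym length-S) (sym length-β)
          (<-≤-trans (m<n+m d (≤-trans (s≤s z≤n) (m≤n+m 3 a))) (m≤n+m (a + 3 + d) F))

  covers-β⇒ : Covers S (βj) → ¬ s k ≡ b0101
  covers-β⇒ cov sk with cov (length S) S<β
  ... | zero  , _   , S<S , _   = <-irrefl refl S<S
  ... | suc t , t≤S , _   , occ = ¬occursAt-β sk (suc t) (s≤s z≤n) t≤S occ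

lemma6 : (q : ℕ) → (s : Fin (suc q) → Vec Bool 4) →
         (∀ k → Pointwise BitMatch (toList (s k)) π) →
         (k : Fin (suc q)) →
         Covers (buildS (suc q) s) (β q (suc (toℕ k))) ⇔ (¬ (s k ≡ b0101))
lemma6 q s hyp k = mk⇔ (covers-β⇒ q s hyp k) (covers-β⇐ q s hyp k)
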